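{- Let $\Gamma \subseteq \mathcal{L}$ be a set of preference statements that is consistent and strongly compositional. Then every maximal $\models^*$-model of $\Gamma$ satisfies $\Gamma$. Moreover, if $\pi$ and $\pi'$ are two maximal $\models^*$-models of $\Gamma$, then $V_\pi = V_{\pi'}$.
   Context: Let $V$ be a finite set of variables, each $X\in V$ having a finite nonempty domain $\underline{X}$. An outcome is an assignment of a value in $\underline{X}$ to every $X\in V$; for an outcome $\alpha$ and $U\subseteq V$, $\alpha(U)$ denotes the restriction of $\alpha$ to $U$. A lexicographic model (lex model) $\pi$ is a (possibly empty) finite sequence $(Y_1,\ge_{Y_1}),\ldots,(Y_k,\ge_{Y_k})$ where the $Y_i\in V$ are pairwise distinct and each $\ge_{Y_i}$ is a total order on $\underline{Y_i}$; $V_\pi=\{Y_1,\ldots,Y_k\}$, and $\mathcal{G}$ is the set of all lex models. For outcomes $\alpha,\beta$: $\alpha\succ_\pi\beta$ iff there is $i$ with $\alpha(Y_j)=\beta(Y_j)$ for all $j<i$ and $\alpha(Y_i)>_{Y_i}\beta(Y_i)$ (strictly); $\alpha\equiv_\pi\beta$ iff $\alpha(V_\pi)=\beta(V_\pi)$; $\alpha\succcurlyeq_\pi\beta$ iff $\alpha\succ_\pi\beta$ or $\alpha\equiv_\pi\beta$. For lex models $\pi$ and $\pi'=(Z_1,\ge_{Z_1}),\ldots,(Z_l,\ge_{Z_l})$, the composition $\pi\circ\pi'$ is the sequence $\pi$ followed by the sequence obtained from $\pi'$ by deleting every pair $(Z_i,\ge_{Z_i})$ with $Z_i\in V_\pi$.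 We say $\pi'$ extends $\pi$ if $\pi'\neq\pi$ and the sequence $\pi'$ begins with the sequence $\pi$; $\pi'\sqsupseteq\pi$ means $\pi'$ extends or equals $\pi$. Let $\mathcal{L}$ be an arbitrary set (of preference statements) with a satisfaction relation $\models\ \subseteq\mathcal{G}\times\mathcal{L}$. For $\Gamma\subseteq\mathcal{L}$, $\pi\models\Gamma$ means $\pi\models\varphi$ for all $\varphi\in\Gamma$ ($\pi$ is then a model of $\Gamma$); $\Gamma$ is consistent if it has a model. Define $\pi\models^*\varphi$ iff there exists $\pi'\in\mathcal{G}$ with $\pi'\sqsupseteq\pi$ and $\pi'\models\varphi$; $\pi\models^*\Gamma$ iff $\pi\models^*\varphi$ for all $\varphi\in\Gamma$. A maximal $\models^*$-model of $\Gamma$ is a $\pi$ with $\pi\models^*\Gamma$ such that no lex model $\pi'$ extending $\pi$ has $\pi'\models^*\Gamma$. A statement $\varphi$ is strongly compositional if for all $\pi,\pi'\in\mathcal{G}$, $\pi\models^*\varphi$ and $\pi'\models\varphi$ imply $\pi\circ\pi'\models\varphi$; a set $\Gamma$ is strongly compositional if each of its elements is. -}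

module Defs where

open import Data.Nat using (ℕ; _<_)
open import Data.Fin using (Fin)
import Data.Fin.Properties as FinP
open import Data.Product using (Σ; ∃; _×_; _,_; proj₁)
open import Data.List using (List; map; filter; _++_)
open import Data.List.Membership.Propositional using (_∈_; _∉_)
open import Data.List.Relation.Unary.Unique.Propositional using (Unique)
open import Data.List.Relation.Unary.All using (All)
open import Relation.Nullary using (¬_; ¬?)
open import Relation.Binary.PropositionalEquality using (_≡_)
open import Function.Bundles using (_⇔_)

module Lex (n : ℕ) (dom : Fin n → ℕ) where

  open import Data.List.Membership.DecPropositional (FinP._≟_ {n}) using (_∈?_)

  -- A total order on the finite domain Fin m, given as the enumeration of
  -- its elements from best to worst (each element exactly once).
  IsTotalOrderList : {m : ℕ} → List (Fin m) → Set
  IsTotalOrderList {m} o = Unique o × (∀ (a : Fin m) → a ∈ o)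

  Pair : Set
  Pair = Σ (Fin n) (λ X → List (Fin (dom X)))

  -- raw sequences; lex models are those satisfying WF
  Seq : Set
  Seq = List Pair

  vars : Seq → List (Fin n)
  vars = map proj₁

  WF : Seq → Set
  WF π = Unique (vars π) × All (λ p → IsTotalOrderList (Data.Product.proj₂ p)) π

  _∘ₗ_ : Seq → Seq → Seq
  π ∘ₗ π' = π ++ filter (λ p → ¬? (proj₁ p ∈? vars π)) π'

  Extends : Seq → Seq → Set
  Extends π' π = ¬ (π' ≡ π) × ∃ λ (s : Seq) → π' ≡ π ++ s

  ExtendsOrEq : Seq → Seq → Set
  ExtendsOrEq π' π = ∃ λ (s : Seq) → π' ≡ π ++ s

  module Sat (L : Set) (_⊨_ : Seq → L → Set) where

    _⊨Γ_ : Seq → (L → Set) → Set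
    π ⊨Γ Γ = ∀ φ → Γ φ → π ⊨ φ

    Consistent : (L → Set) → Set
    Consistent Γ = ∃ λ π → WF π × π ⊨Γ Γ

    _⊨*_ : Seq → L → Set
    π ⊨* φ = ∃ λ π' → WF π' × ExtendsOrEq π' π × π' ⊨ φ

    _⊨*Γ_ : Seq → (L → Set) → Set
    π ⊨*Γ Γ = ∀ φ → Γ φ → π ⊨* φ

    MaximalStarModel : (L → Set) → Seq → Set
    MaximalStarModel Γ π =
      WF π × π ⊨*Γ Γ × (∀ π' → WF π' → Extends π' π → ¬ (π' ⊨*Γ Γ))

    StronglyCompositionalStmt : L → Set
    StronglyCompositionalStmt φ =
      ∀ π π' → WF π → WF π' → π ⊨* φ → π' ⊨ φ → (π ∘ₗ π') ⊨ φ

    StronglyCompositional : (L → Set) → Set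
    StronglyCompositional Γ = ∀ φ → Γ φ → StronglyCompositionalStmt φ

  SameVars : Seq → Seq → Set
  SameVars π π' = ∀ (X : Fin n) → (X ∈ vars π) ⇔ (X ∈ vars π')

{-# OPTIONS --safe #-}
-- Let π be a maximal ⊨*-model of Γ and π₀ any model of Γ. By strong
-- compositionality π ∘ π₀ is a model of Γ, hence a ⊨*-model; it begins with π,
-- so by maximality it adds no pair to π. Thus π ∘ π₀ = π, so π ⊨ Γ, and every
-- variable of π₀ already occurs in π. Once two maximal ⊨*-models are known to be
-- models, the latter fact applied both ways gives V_π = V_π'.
module Submission where

open import Defs
open import Data.Nat using (ℕ; _<_)
open import Data.Fin using (Fin)
open import Data.Fin.Properties using (_≟_)
open import Data.Product using (_×_; _,_; proj₁; proj₂)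
open import Data.List using (List; []; _∷_; map; filter; _++_)
open import Data.List.Properties using (map-++; ++-identityʳ; ++-identityʳ-unique)
open import Data.List.Membership.Propositional using (_∈_; _∉_)
open import Data.List.Membership.Propositional.Properties using (∈-map⁻; ∈-map⁺; ∈-filter⁻; ∈-filter⁺)
open import Data.List.Relation.Unary.Unique.Propositional using (Unique)
import Data.List.Relation.Unary.AllPairs.Properties as AllPairs
import Data.List.Relation.Unary.Unique.Propositional.Properties as Unique
import Data.List.Relation.Unary.All.Properties as All
open import Function using (_∘′_)
open import Function.Bundles using (mk⇔)
open import Relation.Nullary using (¬?; yes; no; contradiction)
open import Relation.Unary using (Decidable)
open import Relation.Binary.PropositionalEquality using (_≡_; refl; sym; cong; subst; module ≡-Reasoning)
open ≡-Reasoning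

Unique-map-filter : ∀ {A B : Set} (f : A → B) {P : A → Set} (P? : Decidable P) {xs : List A} →
  Unique (map f xs) → Unique (map f (filter P? xs))
Unique-map-filter f P? = AllPairs.map⁺ ∘′ AllPairs.filter⁺ P? ∘′ AllPairs.map⁻

module LexProperties (n : ℕ) (dom : Fin n → ℕ) where
  open Lex n dom
  open import Data.List.Membership.DecPropositional (_≟_ {n}) using (_∈?_)

  -- π ∘ₗ π₀ is definitionally π ++ fresh π π₀.
  fresh : Seq → Seq → Seq
  fresh π π₀ = filter (λ p → ¬? (proj₁ p ∈? vars π)) π₀

  ∉-fresh : ∀ π π₀ {X} → X ∈ vars (fresh π π₀) → X ∉ vars π
  ∉-fresh π π₀ X∈ with ∈-map⁻ proj₁ X∈
  ... | _ , p∈ , refl = proj₂ (∈-filter⁻ (λ p → ¬? (proj₁ p ∈? vars π)) {xs = π₀} p∈)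

  ∈-fresh⁺ : ∀ π π₀ {X} → X ∈ vars π₀ → X ∉ vars π → X ∈ vars (fresh π π₀)
  ∈-fresh⁺ π π₀ X∈π₀ X∉π with ∈-map⁻ proj₁ X∈π₀
  ... | _ , p∈ , refl = ∈-map⁺ proj₁ (∈-filter⁺ (λ p → ¬? (proj₁ p ∈? vars π)) p∈ X∉π)

  WF-∘ₗ : ∀ π π₀ → WF π → WF π₀ → WF (π ∘ₗ π₀)
  WF-∘ₗ π π₀ (uniq , orders) (uniq₀ , orders₀) =
      subst Unique (sym (map-++ proj₁ π (fresh π π₀)))
        (Unique.++⁺ uniq (Unique-map-filter proj₁ _ uniq₀) λ (X∈π , X∈fresh) → ∉-fresh π π₀ X∈fresh X∈π)
    , All.++⁺ orders (All.filter⁺ _ orders₀)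

  ++-extends : ∀ π {p s} → Extends (π ++ p ∷ s) π
  ++-extends π = (λ eq → contradiction (++-identityʳ-unique π (sym eq)) λ ()) , _ , refl

  fresh≡[]⇒∘ₗ≡ : ∀ π π₀ → fresh π π₀ ≡ [] → π ∘ₗ π₀ ≡ π
  fresh≡[]⇒∘ₗ≡ π π₀ eq = begin
    π ++ fresh π π₀ ≡⟨ cong (π ++_) eq ⟩
    π ++ []         ≡⟨ ++-identityʳ π ⟩
    π               ∎

  fresh≡[]⇒vars⊆ : ∀ π π₀ → fresh π π₀ ≡ [] → ∀ {X} → X ∈ vars π₀ → X ∈ vars π
  fresh≡[]⇒vars⊆ π π₀ eq {X} X∈π₀ with X ∈? vars π
  ... | yes X∈π = X∈π
  ... | no X∉π with () ← subst (λ s → X ∈ vars s) eq (∈-fresh⁺ π π₀ X∈π₀ X∉π)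

  module SatProperties (L : Set) (_⊨_ : Seq → L → Set) where
    open Sat L _⊨_

    ⊨Γ⇒⊨*Γ : ∀ {π Γ} → WF π → π ⊨Γ Γ → π ⊨*Γ Γ
    ⊨Γ⇒⊨*Γ {π} wf π⊨Γ φ φ∈Γ = π , wf , ([] , sym (++-identityʳ π)) , π⊨Γ φ φ∈Γ

    ∘ₗ-⊨Γ : ∀ {Γ π π₀} → StronglyCompositional Γ → WF π → WF π₀ →
      π ⊨*Γ Γ → π₀ ⊨Γ Γ → (π ∘ₗ π₀) ⊨Γ Γ
    ∘ₗ-⊨Γ {π = π} {π₀} sc wf wf₀ π⊨*Γ π₀⊨Γ φ φ∈Γ =
      sc φ φ∈Γ π π₀ wf wf₀ (π⊨*Γ φ φ∈Γ) (π₀⊨Γ φ φ∈Γ)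

    maximal⇒fresh≡[] : ∀ {Γ π π₀} → StronglyCompositional Γ → MaximalStarModel Γ π →
      WF π₀ → π₀ ⊨Γ Γ → fresh π π₀ ≡ []
    maximal⇒fresh≡[] {π = π} {π₀} sc (wf , π⊨*Γ , maximal) wf₀ π₀⊨Γ with fresh π π₀ in eq
    ... | [] = refl
    ... | _ ∷ _ = contradiction (⊨Γ⇒⊨*Γ wf∘ (∘ₗ-⊨Γ sc wf wf₀ π⊨*Γ π₀⊨Γ)) (maximal (π ∘ₗ π₀) wf∘ extends)
      where
      wf∘ : WF (π ∘ₗ π₀)
      wf∘ = WF-∘ₗ π π₀ wf wf₀

      extends : Extends (π ∘ₗ π₀) π
      extends = subst (λ s → Extends (π ++ s) π) (sym eq) (++-extends π)

    maximal⇒⊨Γ : ∀ {Γ π π₀} → StronglyCompositional Γ → MaximalStarModel Γ π →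
      WF π₀ → π₀ ⊨Γ Γ → π ⊨Γ Γ
    maximal⇒⊨Γ {π = π} {π₀} sc maximal@(wf , π⊨*Γ , _) wf₀ π₀⊨Γ φ φ∈Γ =
      subst (_⊨ φ) (fresh≡[]⇒∘ₗ≡ π π₀ (maximal⇒fresh≡[] sc maximal wf₀ π₀⊨Γ))
        (∘ₗ-⊨Γ sc wf wf₀ π⊨*Γ π₀⊨Γ φ φ∈Γ)

    maximal⇒vars⊇ : ∀ {Γ π π₀} → StronglyCompositional Γ → MaximalStarModel Γ π →
      WF π₀ → π₀ ⊨Γ Γ → ∀ {X} → X ∈ vars π₀ → X ∈ vars π
    maximal⇒vars⊇ {π = π} {π₀} sc maximal wf₀ π₀⊨Γ =
      fresh≡[]⇒vars⊆ π π₀ (maximal⇒fresh≡[] sc maximal wf₀ π₀⊨Γ)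

theorem1 : (n : ℕ) (dom : Fin n → ℕ) → (∀ X → 0 < dom X) →
    (L : Set) (_⊨_ : Lex.Seq n dom → L → Set) (Γ : L → Set) →
    Lex.Sat.Consistent n dom L _⊨_ Γ →
    Lex.Sat.StronglyCompositional n dom L _⊨_ Γ →
    (∀ π → Lex.Sat.MaximalStarModel n dom L _⊨_ Γ π → Lex.Sat._⊨Γ_ n dom L _⊨_ π Γ)
    × (∀ π π' → Lex.Sat.MaximalStarModel n dom L _⊨_ Γ π →
        Lex.Sat.MaximalStarModel n dom L _⊨_ Γ π' → Lex.SameVars n dom π π')
-- Nothing looks inside the orders.
theorem1 n dom _ L _⊨_ Γ (π₀ , wf₀ , π₀⊨Γ) sc = maximal-⊨Γ , maximal-sameVars
  where
  open Lex n dom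
  open Sat L _⊨_
  open LexProperties n dom
  open SatProperties L _⊨_

  maximal-⊨Γ : ∀ π → MaximalStarModel Γ π → π ⊨Γ Γ
  maximal-⊨Γ π maximal = maximal⇒⊨Γ sc maximal wf₀ π₀⊨Γ

  maximal-sameVars : ∀ π π' → MaximalStarModel Γ π →
    MaximalStarModel Γ π' → SameVars π π'
  maximal-sameVars π π' maximal maximal' X = mk⇔
    (maximal⇒vars⊇ sc maximal' (proj₁ maximal) (maximal-⊨Γ π maximal))
    (maximal⇒vars⊇ sc maximal (proj₁ maximal') (maximal-⊨Γ π' maximal'))
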